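{- Let $S$ be a finite set with $|S|=s$, let $b\ge 2$ be an integer and $t>0$. Let $\mathcal T$ be a finite rooted tree such that: the nodes of $\mathcal T$ are subsets of $S$ and the root is $S$; the children of each internal node $U$ of $\mathcal T$ form a partition of $U$ into at most $b$ blocks; the leaves of $\mathcal T$ are $U_1,\dots,U_r$, where $u_i:=|U_i|\le t$ and $d_i$ is the depth of $U_i$. Then \[ \sum_{i=1}^r u_i d_i\ \ge\ s\log_b(s/t). \]
   Context: The depth of a node is its distance from the root (the root has depth $0$).
   Formalization: The parameter t ranges over the positive rationals. -}

module Defs where

open import Data.Nat using (ℕ; zero; suc; _+_; _*_; _≤_)
open import Data.Fin using (Fin; zero; suc)
open import Data.Fin.Subset using (Subset; _∈_; _∩_; Nonempty; Empty; ∣_∣)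
open import Data.List using (List; []; _∷_; map; concat; tabulate)
open import Data.Nat.ListAction using (sum)
open import Data.Product using (Σ; ∃; _×_; _,_; proj₁; proj₂)
open import Relation.Binary.PropositionalEquality using (_≢_)
open import Function.Bundles using (_⇔_)
open import Data.Rational as ℚ using (ℚ; 1ℚ)
open import Data.Integer using (+_)

record IsPartition {s n : ℕ} (U : Subset s) (blocks : Fin n → Subset s) : Set where
  field
    nonempty : ∀ i → Nonempty (blocks i)
    disjoint : ∀ i j → i ≢ j → Empty (blocks i ∩ blocks j)
    covers   : ∀ x → (x ∈ U) ⇔ (∃ λ i → x ∈ blocks i)

data Tree {s : ℕ} (b : ℕ) : Subset s → Set where
  leaf : (U : Subset s) → Tree b U
  node : (U : Subset s) (n : ℕ) → 1 ≤ n → n ≤ b →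
         (blocks : Fin n → Subset s) → IsPartition U blocks →
         (children : (i : Fin n) → Tree b (blocks i)) → Tree b U

-- The list of leaves together with their depths; the first argument is the
-- depth of the current node.
leaves : ∀ {s b} {U : Subset s} → ℕ → Tree b U → List (Subset s × ℕ)
leaves d (leaf U) = (U , d) ∷ []
leaves d (node U n _ _ blocks _ children) =
  concat (tabulate {n = n} (λ i → leaves (suc d) (children i)))

weightedDepth : ∀ {s b} {U : Subset s} → Tree b U → ℕ
weightedDepth T = sum (map (λ p → ∣ proj₁ p ∣ * proj₂ p) (leaves 0 T))

_^ℚ_ : ℚ → ℕ → ℚ
q ^ℚ zero = 1ℚ
q ^ℚ suc k = q ℚ.* (q ^ℚ k)

ℕ→ℚ : ℕ → ℚ
ℕ→ℚ n = (+ n) ℚ./ 1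

{-# OPTIONS --safe #-}
-- Let k ≤ t be a natural bound on the leaf sizes. By induction on the tree, a subtree at depth d
-- with root U satisfies |U|^|U| · b^(d|U|) ≤ k^|U| · b^(Σ u_i d_i), the sum over its leaves.
-- At an internal node whose blocks have sizes c_1, …, c_n (n ≤ b) summing to v = |U|, the step
-- is the entropy bound v^v ≤ n^v ∏ c_i^c_i, i.e. H(c/v) ≤ log n. It follows by merging the
-- classes one at a time with a two-class Gibbs inequality, which is weighted AM–GM, which in
-- turn comes from Bernoulli's inequality. At the root (d = 0, |U| = s) the invariant reads
-- s^s ≤ k^s · b^(Σ u_i d_i), the exponentiated form of the theorem.
module Submission where

open import Defs
open import Data.Nat using (ℕ; _≤_; _^_)
open import Data.Fin.Subset using (⊤; ∣_∣)
open import Data.List.Relation.Unary.All using (All)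
open import Data.Product using (proj₁)
open import Data.Rational as ℚ using (ℚ; 0ℚ)

open import Data.Nat
open import Data.Nat.Properties
open import Data.Nat.Coprimality using (1-coprimeTo)
import Data.Nat.Coprimality as Coprimality
open import Data.Nat.ListAction using (sum; product)
open import Data.Nat.ListAction.Properties using (sum-++)
open import Data.Nat.Tactic.RingSolver using (solve-∀)
import Data.Integer as ℤ
import Data.Integer.Properties as ℤ
import Data.Rational.Properties as ℚ
open import Data.Fin using (Fin; zero; suc)
import Data.Fin.Properties as Fin
open import Data.Fin.Subset using (Subset; _∈_; _∩_; _∪_; ⋃; Empty; inside; outside)
open import Data.Fin.Subset.Properties
  using (x∈p∪q⁺; x∈p∪q⁻; x∈p∩q⁺; x∈p∩q⁻; ∉⊥; ∣⊥∣≡0; ∣⊤∣≡n; ⊆-antisym; drop-∷-Empty)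
open import Data.List using (List; []; _∷_; _++_; tabulate; concat; map)
open import Data.List.Properties using (map-++)
open import Data.List.Relation.Unary.All using ([]; _∷_)
import Data.List.Relation.Unary.All as All
open import Data.List.Relation.Unary.All.Properties using (concat⁻; tabulate⁻)
open import Data.Vec using ([]; _∷_; here)
open import Data.Product using (∃; _×_; _,_)
open import Data.Sum using (inj₁; inj₂)
open import Data.Empty using (⊥-elim)
open import Function using (_∘_; Equivalence)
open import Relation.Binary.PropositionalEquality
open import Relation.Nullary using (yes; no)

open ≤-Reasoning

^-distribʳ-* : ∀ m n o → (m * n) ^ o ≡ m ^ o * n ^ o
^-distribʳ-* m n zero    = refl
^-distribʳ-* m n (suc o) = begin-equality
  m * n * (m * n) ^ o     ≡⟨ cong (m * n *_) (^-distribʳ-* m n o) ⟩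
  m * n * (m ^ o * n ^ o) ≡⟨ [m*n]*[o*p]≡[m*o]*[n*p] m n (m ^ o) (n ^ o) ⟩
  m * m ^ o * (n * n ^ o) ∎

n^n≢0 : ∀ n → NonZero (n ^ n)
n^n≢0 zero    = _
n^n≢0 (suc n) = m^n≢0 (suc n) (suc n)

bernoulli : ∀ x e k → x ^ k * (x + suc k * e) ≤ (x + e) ^ suc k
bernoulli x e zero    = ≤-reflexive (identity x e)
  where
  identity : ∀ x e → 1 * (x + 1 * e) ≡ (x + e) * 1
  identity = solve-∀
bernoulli x e (suc k) = begin
  x ^ suc k * (x + suc (suc k) * e)
    ≤⟨ m≤m+n _ _ ⟩
  x * x ^ k * (x + suc (suc k) * e) + x ^ k * (suc k * e * e)
    ≡⟨ identity x e k (x ^ k) ⟩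
  (x + e) * (x ^ k * (x + suc k * e))
    ≤⟨ *-monoʳ-≤ (x + e) (bernoulli x e k) ⟩
  (x + e) * (x + e) ^ suc k ∎
  where
  identity : ∀ x e k X →
    x * X * (x + (2 + k) * e) + X * ((1 + k) * e * e) ≡ (x + e) * (X * (x + (1 + k) * e))
  identity = solve-∀

bernoulli-reverse : ∀ x e k → (x + e) ^ suc k ≤ x ^ suc k + suc k * e * (x + e) ^ k
bernoulli-reverse x e zero    = ≤-reflexive (identity x e)
  where
  identity : ∀ x e → (x + e) * 1 ≡ x * 1 + 1 * e * 1
  identity = solve-∀
bernoulli-reverse x e (suc k) = begin
  (x + e) * Y
    ≤⟨ *-monoʳ-≤ (x + e) (bernoulli-reverse x e k) ⟩
  (x + e) * (A + suc k * e * Z)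
    ≡⟨ expand x e k A Z ⟩
  x * A + e * A + suc k * e * Y
    ≤⟨ +-monoˡ-≤ _ (+-monoʳ-≤ (x * A) (*-monoʳ-≤ e (^-monoˡ-≤ (suc k) (m≤m+n x e)))) ⟩
  x * A + e * Y + suc k * e * Y
    ≡⟨ collect (x * A) e k Y ⟩
  x * A + suc (suc k) * e * Y ∎
  where
  A Y Z : ℕ
  A = x ^ suc k
  Z = (x + e) ^ k
  Y = (x + e) * Z
  expand : ∀ x e k A Z →
    (x + e) * (A + (1 + k) * e * Z) ≡ x * A + e * A + (1 + k) * e * ((x + e) * Z)
  expand = solve-∀
  collect : ∀ a e k Y → a + e * Y + (1 + k) * e * Y ≡ a + (2 + k) * e * Y
  collect = solve-∀

am-gm-one-≤ : ∀ m a e → suc m ^ suc m * (a ^ m * (a + e)) ≤ (m * a + (a + e)) ^ suc m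
am-gm-one-≤ m a e = begin
  k * k ^ m * (a ^ m * (a + e))
    ≡⟨ regroup k a e (k ^ m) (a ^ m) ⟩
  k ^ m * a ^ m * (k * a + k * e)
    ≡⟨ cong (_* (k * a + k * e)) (sym (^-distribʳ-* k a m)) ⟩
  (k * a) ^ m * (k * a + k * e)
    ≤⟨ bernoulli (k * a) e m ⟩
  (k * a + e) ^ k
    ≡⟨ cong (_^ k) (shift m a e) ⟩
  (m * a + (a + e)) ^ k ∎
  where
  k : ℕ
  k = suc m
  regroup : ∀ k a e K A → k * K * (A * (a + e)) ≡ K * A * (k * a + k * e)
  regroup = solve-∀
  shift : ∀ m a e → (1 + m) * a + e ≡ m * a + (a + e)
  shift = solve-∀

am-gm-one-≥ : ∀ m y e → suc m ^ suc m * ((y + e) ^ m * y) ≤ (m * (y + e) + y) ^ suc m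
am-gm-one-≥ m y e = +-cancelʳ-≤ (k * e * (k ^ m * a ^ m)) _ _ (begin
  k * k ^ m * (a ^ m * y) + k * e * (k ^ m * a ^ m)
    ≡⟨ regroup k y e (k ^ m) (a ^ m) ⟩
  k * a * (k ^ m * a ^ m)
    ≡⟨ cong (k * a *_) (sym (^-distribʳ-* k a m)) ⟩
  (k * a) ^ k
    ≤⟨ subst (λ z → z ^ k ≤ W ^ k + k * e * z ^ m) (W+e≡k*a m y e) (bernoulli-reverse W e m) ⟩
  W ^ k + k * e * (k * a) ^ m
    ≡⟨ cong (λ z → W ^ k + k * e * z) (^-distribʳ-* k a m) ⟩
  W ^ k + k * e * (k ^ m * a ^ m) ∎)
  where
  k a W : ℕ
  k = suc m
  a = y + e
  W = m * a + y
  W+e≡k*a : ∀ m y e → m * (y + e) + y + e ≡ (1 + m) * (y + e)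
  W+e≡k*a = solve-∀
  regroup : ∀ k y e K A → k * K * (A * y) + k * e * (K * A) ≡ k * (y + e) * (K * A)
  regroup = solve-∀

am-gm-one : ∀ m a y → suc m ^ suc m * (a ^ m * y) ≤ (m * a + y) ^ suc m
am-gm-one m a y with ≤-total a y
... | inj₁ a≤y with m≤n⇒∃[o]m+o≡n a≤y
...   | e , refl = am-gm-one-≤ m a e
am-gm-one m a y | inj₂ y≤a with m≤n⇒∃[o]m+o≡n y≤a
...   | e , refl = am-gm-one-≥ m y e

am-gm-step : ∀ n S x → suc n ^ suc n * (S ^ n * x) ≤ n ^ n * (S + x) ^ suc n
am-gm-step zero S x = begin
  1 * (1 * x)       ≡⟨ *-identityˡ (1 * x) ⟩
  1 * x             ≤⟨ *-monoʳ-≤ 1 (m≤n+m x S) ⟩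
  1 * (S + x)       ≡⟨ cong (1 *_) (sym (*-identityʳ (S + x))) ⟩
  1 * ((S + x) * 1) ∎
am-gm-step n@(suc _) S x = *-cancelˡ-≤ n (begin
  n * (suc n ^ suc n * (S ^ n * x)) ≡⟨ regroup n (suc n ^ suc n) (S ^ n) x ⟩
  suc n ^ suc n * (S ^ n * (n * x)) ≤⟨ am-gm-one n S (n * x) ⟩
  (n * S + n * x) ^ suc n           ≡⟨ cong (_^ suc n) (sym (*-distribˡ-+ n S x)) ⟩
  (n * (S + x)) ^ suc n             ≡⟨ ^-distribʳ-* n (S + x) (suc n) ⟩
  n ^ suc n * (S + x) ^ suc n       ≡⟨ *-assoc n (n ^ n) _ ⟩
  n * (n ^ n * (S + x) ^ suc n)     ∎)
  where
  regroup : ∀ n K P x → n * (K * (P * x)) ≡ K * (P * (n * x))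
  regroup = solve-∀

am-gm₂ : ∀ c w a x → (c + w) ^ (c + w) * (a ^ c * x ^ w) ≤ (c * a + w * x) ^ (c + w)
am-gm₂ zero w a x = begin
  w ^ w * (1 * x ^ w) ≡⟨ cong (w ^ w *_) (*-identityˡ (x ^ w)) ⟩
  w ^ w * x ^ w       ≡⟨ sym (^-distribʳ-* w x w) ⟩
  (w * x) ^ w         ∎
am-gm₂ (suc c) w a x = *-cancelˡ-≤ (n ^ n) {{n^n≢0 n}} (begin
  n ^ n * (suc n ^ suc n * (a ^ suc c * x ^ w))
    ≡⟨ regroup (n ^ n) (suc n ^ suc n) (a ^ c) (x ^ w) a ⟩
  suc n ^ suc n * (n ^ n * (a ^ c * x ^ w)) * a
    ≤⟨ *-monoˡ-≤ a (*-monoʳ-≤ (suc n ^ suc n) (am-gm₂ c w a x)) ⟩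
  suc n ^ suc n * S ^ n * a
    ≡⟨ *-assoc (suc n ^ suc n) (S ^ n) a ⟩
  suc n ^ suc n * (S ^ n * a)
    ≤⟨ am-gm-step n S a ⟩
  n ^ n * (S + a) ^ suc n
    ≡⟨ cong (λ z → n ^ n * z ^ suc n) (shift c w a x) ⟩
  n ^ n * (suc c * a + w * x) ^ suc n ∎)
  where
  n S : ℕ
  n = c + w
  S = c * a + w * x
  regroup : ∀ N K A X a → N * (K * (a * A * X)) ≡ K * (N * (A * X)) * a
  regroup = solve-∀
  shift : ∀ c w a x → c * a + w * x + a ≡ (1 + c) * a + w * x
  shift = solve-∀

gibbs₂ : ∀ c w p q → (c + w) ^ (c + w) * (p ^ c * q ^ w) ≤ (p + q) ^ (c + w) * (c ^ c * w ^ w)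
gibbs₂ zero w p q = begin
  w ^ w * (1 * q ^ w)       ≡⟨ cong (w ^ w *_) (*-identityˡ (q ^ w)) ⟩
  w ^ w * q ^ w             ≤⟨ *-monoʳ-≤ (w ^ w) (^-monoˡ-≤ w (m≤n+m q p)) ⟩
  w ^ w * (p + q) ^ w       ≡⟨ *-comm (w ^ w) _ ⟩
  (p + q) ^ w * w ^ w       ≡⟨ cong ((p + q) ^ w *_) (sym (*-identityˡ (w ^ w))) ⟩
  (p + q) ^ w * (1 * w ^ w) ∎
gibbs₂ c zero p q rewrite +-identityʳ c = begin
  c ^ c * (p ^ c * 1)       ≡⟨ swap (c ^ c) (p ^ c) ⟩
  p ^ c * (c ^ c * 1)       ≤⟨ *-monoˡ-≤ (c ^ c * 1) (^-monoˡ-≤ c (m≤m+n p q)) ⟩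
  (p + q) ^ c * (c ^ c * 1) ∎
  where
  swap : ∀ a b → a * (b * 1) ≡ b * (a * 1)
  swap = solve-∀
-- AM–GM for c copies of p·w and w copies of q·c, divided by w^c · c^w.
gibbs₂ c@(suc _) w@(suc _) p q = *-cancelˡ-≤ (w ^ c * c ^ w) {{w^c*c^w≢0}} (begin
  w ^ c * c ^ w * (n ^ n * (p ^ c * q ^ w))
    ≡⟨ regroup (w ^ c) (c ^ w) (n ^ n) (p ^ c) (q ^ w) ⟩
  n ^ n * (p ^ c * w ^ c * (q ^ w * c ^ w))
    ≡⟨ cong₂ (λ u v → n ^ n * (u * v)) (sym (^-distribʳ-* p w c)) (sym (^-distribʳ-* q c w)) ⟩
  n ^ n * ((p * w) ^ c * (q * c) ^ w)
    ≤⟨ am-gm₂ c w (p * w) (q * c) ⟩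
  (c * (p * w) + w * (q * c)) ^ n
    ≡⟨ cong (_^ n) (factor c w p q) ⟩
  ((p + q) * (c * w)) ^ n
    ≡⟨ ^-distribʳ-* (p + q) (c * w) n ⟩
  (p + q) ^ n * (c * w) ^ n
    ≡⟨ cong ((p + q) ^ n *_) (^-distribʳ-* c w n) ⟩
  (p + q) ^ n * (c ^ n * w ^ n)
    ≡⟨ cong₂ (λ u v → (p + q) ^ n * (u * v)) (^-distribˡ-+-* c c w) (^-distribˡ-+-* w c w) ⟩
  (p + q) ^ n * (c ^ c * c ^ w * (w ^ c * w ^ w))
    ≡⟨ regroup′ ((p + q) ^ n) (c ^ c) (c ^ w) (w ^ c) (w ^ w) ⟩
  w ^ c * c ^ w * ((p + q) ^ n * (c ^ c * w ^ w)) ∎)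
  where
  n : ℕ
  n = c + w
  w^c*c^w≢0 : NonZero (w ^ c * c ^ w)
  w^c*c^w≢0 = m*n≢0 (w ^ c) (c ^ w) {{m^n≢0 w c}} {{m^n≢0 c w}}
  regroup : ∀ Wc Cw N Pc Qw → Wc * Cw * (N * (Pc * Qw)) ≡ N * (Pc * Wc * (Qw * Cw))
  regroup = solve-∀
  factor : ∀ c w p q → c * (p * w) + w * (q * c) ≡ (p + q) * (c * w)
  factor = solve-∀
  regroup′ : ∀ R Cc Cw Wc Ww → R * (Cc * Cw * (Wc * Ww)) ≡ Wc * Cw * (R * (Cc * Ww))
  regroup′ = solve-∀

entropy-bound : ∀ {n} (c : Fin n → ℕ) →
  sum (tabulate c) ^ sum (tabulate c) ≤ n ^ sum (tabulate c) * product (tabulate (λ i → c i ^ c i))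
entropy-bound {zero}  c = ≤-refl
entropy-bound {suc m} c = *-cancelˡ-≤ (w ^ w) {{n^n≢0 w}} (begin
  w ^ w * v ^ v
    ≤⟨ *-monoˡ-≤ (v ^ v) (entropy-bound (c ∘ suc)) ⟩
  m ^ w * P * v ^ v
    ≡⟨ regroup (m ^ w) P (v ^ v) ⟩
  v ^ v * (1 * m ^ w) * P
    ≡⟨ cong (λ z → v ^ v * (z * m ^ w) * P) (sym (^-zeroˡ c₀)) ⟩
  v ^ v * (1 ^ c₀ * m ^ w) * P
    ≤⟨ *-monoˡ-≤ P (gibbs₂ c₀ w 1 m) ⟩
  suc m ^ v * (c₀ ^ c₀ * w ^ w) * P
    ≡⟨ regroup′ (suc m ^ v) (c₀ ^ c₀) (w ^ w) P ⟩
  w ^ w * (suc m ^ v * (c₀ ^ c₀ * P)) ∎)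
  where
  c₀ w v P : ℕ
  c₀ = c zero
  w = sum (tabulate (c ∘ suc))
  v = c₀ + w
  P = product (tabulate (λ i → c (suc i) ^ c (suc i)))
  regroup : ∀ M P V → M * P * V ≡ V * (1 * M) * P
  regroup = solve-∀
  regroup′ : ∀ N C W P → N * (C * W) * P ≡ W * (N * (C * P))
  regroup′ = solve-∀

sum-map-concat-tabulate : ∀ {A : Set} {n} (f : A → ℕ) (g : Fin n → List A) →
  sum (map f (concat (tabulate g))) ≡ sum (tabulate (λ i → sum (map f (g i))))
sum-map-concat-tabulate {n = zero}  f g = refl
sum-map-concat-tabulate {n = suc n} f g = begin-equality
  sum (map f (g zero ++ concat (tabulate (g ∘ suc))))
    ≡⟨ cong sum (map-++ f (g zero) _) ⟩
  sum (map f (g zero) ++ map f (concat (tabulate (g ∘ suc))))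
    ≡⟨ sum-++ (map f (g zero)) _ ⟩
  sum (map f (g zero)) + sum (map f (concat (tabulate (g ∘ suc))))
    ≡⟨ cong (sum (map f (g zero)) +_) (sum-map-concat-tabulate f (g ∘ suc)) ⟩
  sum (map f (g zero)) + sum (tabulate (λ i → sum (map f (g (suc i))))) ∎

sum-tabulate-*ˡ : ∀ {n} m (f : Fin n → ℕ) → sum (tabulate (λ i → m * f i)) ≡ m * sum (tabulate f)
sum-tabulate-*ˡ {zero}  m f = sym (*-zeroʳ m)
sum-tabulate-*ˡ {suc n} m f =
  trans (cong (m * f zero +_) (sum-tabulate-*ˡ m (f ∘ suc))) (sym (*-distribˡ-+ m (f zero) _))

product-tabulate-* : ∀ {n} (f g : Fin n → ℕ) →
  product (tabulate (λ i → f i * g i)) ≡ product (tabulate f) * product (tabulate g)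
product-tabulate-* {zero}  f g = refl
product-tabulate-* {suc n} f g =
  trans (cong (f zero * g zero *_) (product-tabulate-* (f ∘ suc) (g ∘ suc)))
        ([m*n]*[o*p]≡[m*o]*[n*p] (f zero) (g zero) _ _)

product-tabulate-^ : ∀ {n} m (f : Fin n → ℕ) →
  product (tabulate (λ i → m ^ f i)) ≡ m ^ sum (tabulate f)
product-tabulate-^ {zero}  m f = refl
product-tabulate-^ {suc n} m f =
  trans (cong (m ^ f zero *_) (product-tabulate-^ m (f ∘ suc))) (sym (^-distribˡ-+-* m (f zero) _))

product-tabulate-mono-≤ : ∀ {n} {f g : Fin n → ℕ} → (∀ i → f i ≤ g i) →
  product (tabulate f) ≤ product (tabulate g)
product-tabulate-mono-≤ {zero}  f≤g = ≤-refl
product-tabulate-mono-≤ {suc n} f≤g = *-mono-≤ (f≤g zero) (product-tabulate-mono-≤ (f≤g ∘ suc))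

module _ {s : ℕ} where

  ∈⋃-tabulate⁺ : ∀ {n} (B : Fin n → Subset s) {x} i → x ∈ B i → x ∈ ⋃ (tabulate B)
  ∈⋃-tabulate⁺ B zero    x∈Bᵢ = x∈p∪q⁺ (inj₁ x∈Bᵢ)
  ∈⋃-tabulate⁺ B (suc i) x∈Bᵢ = x∈p∪q⁺ (inj₂ (∈⋃-tabulate⁺ (B ∘ suc) i x∈Bᵢ))

  ∈⋃-tabulate⁻ : ∀ {n} (B : Fin n → Subset s) {x} → x ∈ ⋃ (tabulate B) → ∃ λ i → x ∈ B i
  ∈⋃-tabulate⁻ {zero}  B x∈⊥ = ⊥-elim (∉⊥ x∈⊥)
  ∈⋃-tabulate⁻ {suc n} B x∈⋃ with x∈p∪q⁻ (B zero) _ x∈⋃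
  ... | inj₁ x∈B₀ = zero , x∈B₀
  ... | inj₂ x∈⋃′ with ∈⋃-tabulate⁻ (B ∘ suc) x∈⋃′
  ...   | i , x∈Bᵢ = suc i , x∈Bᵢ

∣p∪q∣≡∣p∣+∣q∣ : ∀ {s} {p q : Subset s} → Empty (p ∩ q) → ∣ p ∪ q ∣ ≡ ∣ p ∣ + ∣ q ∣
∣p∪q∣≡∣p∣+∣q∣ {p = []}          {[]}          _     = refl
∣p∪q∣≡∣p∣+∣q∣ {p = outside ∷ p} {outside ∷ q} empty = ∣p∪q∣≡∣p∣+∣q∣ (drop-∷-Empty empty)
∣p∪q∣≡∣p∣+∣q∣ {p = inside  ∷ p} {outside ∷ q} empty = cong suc (∣p∪q∣≡∣p∣+∣q∣ (drop-∷-Empty empty))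
∣p∪q∣≡∣p∣+∣q∣ {p = outside ∷ p} {inside  ∷ q} empty =
  trans (cong suc (∣p∪q∣≡∣p∣+∣q∣ (drop-∷-Empty empty))) (sym (+-suc ∣ p ∣ ∣ q ∣))
∣p∪q∣≡∣p∣+∣q∣ {p = inside  ∷ p} {inside  ∷ q} empty = ⊥-elim (empty (zero , here))

PairwiseDisjoint : ∀ {s n} → (Fin n → Subset s) → Set
PairwiseDisjoint B = ∀ i j → i ≢ j → Empty (B i ∩ B j)

∣⋃∣≡sum∣∣ : ∀ {s n} (B : Fin n → Subset s) → PairwiseDisjoint B →
            ∣ ⋃ (tabulate B) ∣ ≡ sum (tabulate (∣_∣ ∘ B))
∣⋃∣≡sum∣∣ {s} {zero}  B _        = ∣⊥∣≡0 s
∣⋃∣≡sum∣∣ {s} {suc n} B disjoint = begin-equality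
  ∣ B zero ∪ ⋃ (tabulate (B ∘ suc)) ∣         ≡⟨ ∣p∪q∣≡∣p∣+∣q∣ B₀∩⋃≡∅ ⟩
  ∣ B zero ∣ + ∣ ⋃ (tabulate (B ∘ suc)) ∣     ≡⟨ cong (∣ B zero ∣ +_) (∣⋃∣≡sum∣∣ (B ∘ suc) disjoint′) ⟩
  ∣ B zero ∣ + sum (tabulate (∣_∣ ∘ B ∘ suc)) ∎
  where
  disjoint′ : PairwiseDisjoint (B ∘ suc)
  disjoint′ i j i≢j = disjoint (suc i) (suc j) (i≢j ∘ Fin.suc-injective)
  B₀∩⋃≡∅ : Empty (B zero ∩ ⋃ (tabulate (B ∘ suc)))
  B₀∩⋃≡∅ (x , x∈∩) with x∈p∩q⁻ (B zero) _ x∈∩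
  ... | x∈B₀ , x∈⋃ with ∈⋃-tabulate⁻ (B ∘ suc) x∈⋃
  ...   | i , x∈Bᵢ = disjoint zero (suc i) (λ ()) (x , x∈p∩q⁺ (x∈B₀ , x∈Bᵢ))

module _ {s n} {U : Subset s} {blocks : Fin n → Subset s} (partition : IsPartition U blocks) where
  open IsPartition partition

  partition≡⋃blocks : U ≡ ⋃ (tabulate blocks)
  partition≡⋃blocks = ⊆-antisym
    (λ {x} x∈U → let i , x∈Bᵢ = Equivalence.to (covers x) x∈U in ∈⋃-tabulate⁺ blocks i x∈Bᵢ)
    (λ {x} x∈⋃ → Equivalence.from (covers x) (∈⋃-tabulate⁻ blocks x∈⋃))

  ∣U∣≡sum∣blocks∣ : ∣ U ∣ ≡ sum (tabulate (∣_∣ ∘ blocks))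
  ∣U∣≡sum∣blocks∣ = trans (cong ∣_∣ partition≡⋃blocks) (∣⋃∣≡sum∣∣ blocks disjoint)

module _ {s b : ℕ} where

  leafWeight : Subset s × ℕ → ℕ
  leafWeight (U , d) = ∣ U ∣ * d

  depthWeight : {U : Subset s} → ℕ → Tree b U → ℕ
  depthWeight d T = sum (map leafWeight (leaves d T))

  self-power-bound : ∀ {k} d {U} (T : Tree b U) → All (λ leaf → ∣ proj₁ leaf ∣ ≤ k) (leaves d T) →
    ∣ U ∣ ^ ∣ U ∣ * b ^ (d * ∣ U ∣) ≤ k ^ ∣ U ∣ * b ^ depthWeight d T
  self-power-bound d (leaf U) (∣U∣≤k ∷ []) =
    *-mono-≤ (^-monoˡ-≤ ∣ U ∣ ∣U∣≤k) (≤-reflexive (cong (b ^_) (swap d ∣ U ∣)))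
    where
    swap : ∀ d u → d * u ≡ u * d + 0
    swap = solve-∀
  self-power-bound {k} d T@(node U n _ n≤b B partition child) bounded
    rewrite ∣U∣≡sum∣blocks∣ partition = begin
    v ^ v * b ^ (d * v)
      ≤⟨ *-monoˡ-≤ (b ^ (d * v)) (entropy-bound c) ⟩
    n ^ v * ∏c^c * b ^ (d * v)
      ≤⟨ *-monoˡ-≤ (b ^ (d * v)) (*-monoˡ-≤ ∏c^c (^-monoˡ-≤ v n≤b)) ⟩
    b ^ v * ∏c^c * b ^ (d * v)
      ≡⟨ regroup (b ^ v) ∏c^c (b ^ (d * v)) ⟩
    ∏c^c * (b ^ v * b ^ (d * v))
      ≡⟨ cong (∏c^c *_) (sym (^-distribˡ-+-* b v (d * v))) ⟩
    ∏c^c * b ^ (suc d * v)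
      ≡⟨ cong (λ z → ∏c^c * b ^ z) (sym (sum-tabulate-*ˡ (suc d) c)) ⟩
    ∏c^c * b ^ sum (tabulate (λ i → suc d * c i))
      ≡⟨ cong (∏c^c *_) (sym (product-tabulate-^ b (λ i → suc d * c i))) ⟩
    ∏c^c * product (tabulate (λ i → b ^ (suc d * c i)))
      ≡⟨ sym (product-tabulate-* (λ i → c i ^ c i) (λ i → b ^ (suc d * c i))) ⟩
    product (tabulate (λ i → c i ^ c i * b ^ (suc d * c i)))
      ≤⟨ product-tabulate-mono-≤ (λ i → self-power-bound (suc d) (child i) (tabulate⁻ (concat⁻ bounded) i)) ⟩
    product (tabulate (λ i → k ^ c i * b ^ w i))
      ≡⟨ product-tabulate-* (λ i → k ^ c i) (λ i → b ^ w i) ⟩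
    product (tabulate (λ i → k ^ c i)) * product (tabulate (λ i → b ^ w i))
      ≡⟨ cong₂ _*_ (product-tabulate-^ k c) (product-tabulate-^ b w) ⟩
    k ^ v * b ^ sum (tabulate w)
      ≡⟨ cong (λ z → k ^ v * b ^ z) (sym (sum-map-concat-tabulate leafWeight (λ i → leaves (suc d) (child i)))) ⟩
    k ^ v * b ^ depthWeight d T ∎
    where
    c w : Fin n → ℕ
    c = ∣_∣ ∘ B
    w i = depthWeight (suc d) (child i)
    v ∏c^c : ℕ
    v = sum (tabulate c)
    ∏c^c = product (tabulate (λ i → c i ^ c i))
    regroup : ∀ X P Y → X * P * Y ≡ P * (X * Y)
    regroup = solve-∀

s^s≤k^s*b^weightedDepth : ∀ {s b k} (T : Tree {s} b ⊤) →
  All (λ leaf → ∣ proj₁ leaf ∣ ≤ k) (leaves 0 T) → s ^ s ≤ k ^ s * b ^ weightedDepth T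
s^s≤k^s*b^weightedDepth {s} {b} {k} T bounded =
  subst (λ u → u ^ u ≤ k ^ u * b ^ weightedDepth T) (∣⊤∣≡n s)
        (≤-trans (≤-reflexive (sym (*-identityʳ _))) (self-power-bound 0 T bounded))

ℕ→ℚ≡mkℚ : ∀ n → ℕ→ℚ n ≡ ℚ.mkℚ (ℤ.+ n) 0 (Coprimality.sym (1-coprimeTo n))
ℕ→ℚ≡mkℚ n = ℚ.normalize-coprime (Coprimality.sym (1-coprimeTo n))

ℕ→ℚ-* : ∀ m n → ℕ→ℚ (m * n) ≡ ℕ→ℚ m ℚ.* ℕ→ℚ n
ℕ→ℚ-* m n rewrite ℕ→ℚ≡mkℚ m | ℕ→ℚ≡mkℚ n = cong (ℚ._/ 1) (ℤ.pos-* m n)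

ℕ→ℚ-^ : ∀ m n → ℕ→ℚ (m ^ n) ≡ ℕ→ℚ m ^ℚ n
ℕ→ℚ-^ m zero    = refl
ℕ→ℚ-^ m (suc n) = trans (ℕ→ℚ-* m (m ^ n)) (cong (ℕ→ℚ m ℚ.*_) (ℕ→ℚ-^ m n))

ℕ→ℚ-mono-≤ : ∀ {m n} → m ≤ n → ℕ→ℚ m ℚ.≤ ℕ→ℚ n
ℕ→ℚ-mono-≤ {m} {n} m≤n rewrite ℕ→ℚ≡mkℚ m | ℕ→ℚ≡mkℚ n =
  ℚ.*≤* (subst₂ ℤ._≤_ (sym (ℤ.*-identityʳ (ℤ.+ m))) (sym (ℤ.*-identityʳ (ℤ.+ n))) (ℤ.+≤+ m≤n))

ℕ→ℚ-nonNeg : ∀ n → ℚ.NonNegative (ℕ→ℚ n)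
ℕ→ℚ-nonNeg n = ℚ.normalize-nonNeg n 1

^ℚ-nonNeg : ∀ n {p} .{{_ : ℚ.NonNegative p}} → ℚ.NonNegative (p ^ℚ n)
^ℚ-nonNeg zero        = _
^ℚ-nonNeg (suc n) {p} = ℚ.nonNeg*nonNeg⇒nonNeg p (p ^ℚ n) {{^ℚ-nonNeg n}}

^ℚ-monoˡ-≤ : ∀ n {p q} .{{_ : ℚ.NonNegative p}} → p ℚ.≤ q → p ^ℚ n ℚ.≤ q ^ℚ n
^ℚ-monoˡ-≤ zero          p≤q = ℚ.≤-refl
^ℚ-monoˡ-≤ (suc n) {p} {q} p≤q =
  ℚ.≤-trans (ℚ.*-monoʳ-≤-nonNeg (p ^ℚ n) {{^ℚ-nonNeg n}} p≤q)
            (ℚ.*-monoˡ-≤-nonNeg q {{q-nonNeg}} (^ℚ-monoˡ-≤ n p≤q))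
  where
  q-nonNeg : ℚ.NonNegative q
  q-nonNeg = ℚ.nonNegative (ℚ.≤-trans (ℚ.nonNegative⁻¹ p) p≤q)

m≤k^s*n⇒m≤t^s*n : ∀ {m n t} k s → m ≤ k ^ s * n → ℕ→ℚ k ℚ.≤ t → ℕ→ℚ m ℚ.≤ t ^ℚ s ℚ.* ℕ→ℚ n
m≤k^s*n⇒m≤t^s*n {m} {n} k s m≤k^s*n k≤t =
  ℚ.≤-trans (ℚ.≤-trans (ℕ→ℚ-mono-≤ m≤k^s*n) (ℚ.≤-reflexive cast))
            (ℚ.*-monoʳ-≤-nonNeg (ℕ→ℚ n) {{ℕ→ℚ-nonNeg n}} (^ℚ-monoˡ-≤ s {{ℕ→ℚ-nonNeg k}} k≤t))
  where
  cast : ℕ→ℚ (k ^ s * n) ≡ ℕ→ℚ k ^ℚ s ℚ.* ℕ→ℚ n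
  cast = trans (ℕ→ℚ-* (k ^ s) n) (cong (ℚ._* ℕ→ℚ n) (ℕ→ℚ-^ k s))

bounded⇒ℕ-bounded : ∀ {A : Set} (size : A → ℕ) {t} → 0ℚ ℚ.≤ t → ∀ xs →
  All (λ x → ℕ→ℚ (size x) ℚ.≤ t) xs → ∃ λ k → All (λ x → size x ≤ k) xs × ℕ→ℚ k ℚ.≤ t
bounded⇒ℕ-bounded size 0≤t []       []           = 0 , [] , 0≤t
bounded⇒ℕ-bounded size 0≤t (x ∷ xs) (x≤t ∷ xs≤t) with bounded⇒ℕ-bounded size 0≤t xs xs≤t
... | k , xs≤k , k≤t with size x ≤? k
...   | yes x≤k = k , x≤k ∷ xs≤k , k≤t
...   | no  x≰k = size x , ≤-refl ∷ All.map (λ y≤k → ≤-trans y≤k (<⇒≤ (≰⇒> x≰k))) xs≤k , x≤t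

-- The hypothesis 2 ≤ b only serves to make log_b meaningful in the logarithmic form.
lemma3p2 : (s b : ℕ) → 2 ≤ b → (t : ℚ) → 0ℚ ℚ.< t →
           (T : Tree {s} b ⊤) →
           All (λ p → ℕ→ℚ ∣ proj₁ p ∣ ℚ.≤ t) (leaves 0 T) →
           ℕ→ℚ (s ^ s) ℚ.≤ (t ^ℚ s) ℚ.* ℕ→ℚ (b ^ weightedDepth T)
lemma3p2 s b _ t 0<t T leaves≤t
  with bounded⇒ℕ-bounded (∣_∣ ∘ proj₁) (ℚ.<⇒≤ 0<t) (leaves 0 T) leaves≤t
... | k , leaves≤k , k≤t = m≤k^s*n⇒m≤t^s*n k s (s^s≤k^s*b^weightedDepth T leaves≤k) k≤t
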